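{- Let $m\geq1$, let $M=(E,r)$ be a loopless matroid, and let $Q=Q_m(M)$ with rank function $r_Q$ and closure operator $\mathrm{cl}_Q$. For every $S\subseteq E(Q)$, $$r_Q(p(S))=\begin{cases} r_Q(S), & \text{if } a\notin\mathrm{cl}_Q(S),\\ r_Q(S)-1, & \text{if } a\in\mathrm{cl}_Q(S).\end{cases}$$
   Context: Cyclic set: $X$ with $M|X$ having no coloops; cyclic flat: a flat that is cyclic; $\mathcal{Z}(M)$: the set of cyclic flats. Free $m$-cone: let $M=(E,r)$ be loopless and $m\geq1$. For each $e\in E$ let $T_e$ be a set of $m$ new elements (pairwise disjoint, disjoint from $E$), $T=\bigcup_e T_e$, and $a$ a further new element (the tip); $E(Q)=E\cup T\cup\{a\}$. For $S\subseteq E$ let $q(S)=S\cup\{a\}\cup\bigcup_{e\in S}T_e$, and for $S\subseteq E(Q)$ let $p(S)=(S\cap E)\cup\{e\in E: S\cap T_e\neq\varnothing\}$. The free $m$-cone $Q=Q_m(M)$ is the unique matroid on $E(Q)$ whose cyclic flats are exactly the sets in $\mathcal{Z}(M)\cup\{q(F):F\text{ a nonempty flat of }M\}$, with rank $r(Z)$ on $Z\in\mathcal{Z}(M)$ and rank $r(F)+1$ on $q(F)$. -}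

module Defs where

open import Data.Nat using (ℕ; zero; suc; _+_; _*_; _≤_)
open import Data.Bool using (Bool; true; false; _∧_; _∨_)
open import Data.Fin using (Fin; zero; suc; splitAt; remQuot; _↑ʳ_)
import Data.Fin.Properties as FinP
open import Data.Fin.Subset using (Subset; _∈_; _∉_; _⊆_; _∪_; _∩_; _-_; ⁅_⁆; ∣_∣; Nonempty)
open import Data.Vec using (tabulate; lookup)
open import Data.Sum using (_⊎_; inj₁; inj₂)
open import Data.Product using (Σ; _×_; _,_)
open import Relation.Binary.PropositionalEquality using (_≡_)
open import Relation.Nullary.Decidable using (⌊_⌋)
import Data.Nat.Properties as NatP

record Matroid (n : ℕ) : Set where
  field
    r      : Subset n → ℕ
    r-card : ∀ X → r X ≤ ∣ X ∣
    r-mono : ∀ X Y → X ⊆ Y → r X ≤ r Y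
    r-sub  : ∀ X Y → r (X ∪ Y) + r (X ∩ Y) ≤ r X + r Y

module _ {n : ℕ} (M : Matroid n) where
  open Matroid M

  cl : Subset n → Subset n
  cl X = tabulate (λ e → ⌊ r (X ∪ ⁅ e ⁆) NatP.≟ r X ⌋)

  IsFlat : Subset n → Set
  IsFlat X = cl X ≡ X

  IsCyclic : Subset n → Set
  IsCyclic X = ∀ e → e ∈ X → r (X - e) ≡ r X

  IsCyclicFlat : Subset n → Set
  IsCyclicFlat X = IsFlat X × IsCyclic X

  Loopless : Set
  Loopless = ∀ e → r ⁅ e ⁆ ≡ 1

-- Ground set of the free m-cone: E(Q) = E ⊔ T ⊔ {a} encoded as
-- Fin (n + (n * m + 1)), laid out as E, then T (T_e = block e of size m),
-- then the tip a.

QSize : ℕ → ℕ → ℕ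
QSize n m = n + (n * m + 1)

data Elt (n m : ℕ) : Set where
  el   : Fin n → Elt n m
  tee  : Fin n → Fin m → Elt n m
  apex : Elt n m

decode : (n m : ℕ) → Fin (QSize n m) → Elt n m
decode n m x with splitAt n x
... | inj₁ e = el e
... | inj₂ y with splitAt (n * m) y
...   | inj₁ t with remQuot {n} m t
...     | (e , j) = tee e j
decode n m x | inj₂ y | inj₂ _ = apex

tip : (n m : ℕ) → Fin (QSize n m)
tip n m = n ↑ʳ ((n * m) ↑ʳ zero)

embed : (n m : ℕ) → Subset n → Subset (QSize n m)
embed n m Z = tabulate λ x → emb (decode n m x)
  where
  emb : Elt n m → Bool
  emb (el e)    = lookup Z e
  emb (tee _ _) = false
  emb apex      = false

q : (n m : ℕ) → Subset n → Subset (QSize n m)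
q n m S = tabulate λ x → qq (decode n m x)
  where
  qq : Elt n m → Bool
  qq (el e)    = lookup S e
  qq (tee e _) = lookup S e
  qq apex      = true

anyFin : (k : ℕ) → (Fin k → Bool) → Bool
anyFin zero    f = false
anyFin (suc k) f = f zero ∨ anyFin k (λ i → f (suc i))

p : (n m : ℕ) → Subset (QSize n m) → Subset n
p n m S = tabulate λ e → anyFin (QSize n m) (λ x → lookup S x ∧ over e (decode n m x))
  where
  over : Fin n → Elt n m → Bool
  over e (el e')    = ⌊ e FinP.≟ e' ⌋
  over e (tee e' _) = ⌊ e FinP.≟ e' ⌋
  over e apex       = false

_⇔'_ : Set → Set → Set
A ⇔' B = (A → B) × (B → A)
infix 3 _⇔'_

-- Q is (the) free m-cone of M: its cyclic flats are exactly the sets in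
-- Z(M) ∪ { q(F) : F nonempty flat of M }, with the prescribed ranks.
record IsFreeCone {n : ℕ} (m : ℕ) (M : Matroid n) (Q : Matroid (QSize n m)) : Set where
  field
    cyclicFlats : ∀ Z → IsCyclicFlat Q Z ⇔' ((Σ (Subset n) λ Z' → IsCyclicFlat M Z' × Z ≡ embed n m Z')
                                           ⊎ (Σ (Subset n) λ F → IsFlat M F × Nonempty F × Z ≡ q n m F))
    rank-Z : ∀ Z → IsCyclicFlat M Z → Matroid.r Q (embed n m Z) ≡ Matroid.r M Z
    rank-q : ∀ F → IsFlat M F → Nonempty F → Matroid.r Q (q n m F) ≡ Matroid.r M F + 1

module Submission where

-- Write a for the tip. An element x ≠ a lies over some e ∈ E (x = e or x ∈ T_e); then q(cl_M{e}) is a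
-- rank-two cyclic flat containing a and all elements over e, while {a, x} already has rank two, so every
-- element over e lies in cl_Q{a, x}. Hence S ∪ {a} and p(S) ∪ {a} span each other and have equal rank.
-- Comparing with the cyclic flats of Q shows that a is in the closure of no subset of E, so
-- r_Q(p(S) ∪ {a}) = r_Q(p(S)) + 1, whereas r_Q(S ∪ {a}) is r_Q(S) + 1 or r_Q(S) according as a ∉ cl_Q(S)
-- or a ∈ cl_Q(S). Ranks in Q are only known on cyclic flats; they are reached through the bound
-- r(X) ≥ r(Z) + |X ─ Z| for a suitable cyclic flat Z.

open import Defs
open import Data.Nat using (ℕ; zero; suc; _+_; _*_; _≤_; _<_; _≥_; z≤n; s≤s)
open import Data.Nat.Properties
  using (≤-refl; ≤-trans; ≤-reflexive; ≤-antisym; ≤∧≢⇒<; <-≤-trans; ≤-<-trans; <-irrefl;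
         n≤1+n; n<1+n; m≤m+n; m≤n+m; +-comm; +-suc; +-identityʳ; +-monoʳ-≤; +-monoʳ-<; +-mono-≤;
         +-cancelʳ-≤; suc-injective; module ≤-Reasoning)
  renaming (_≟_ to _≟ℕ_)
open import Data.Nat.Induction using (<-wellFounded)
open import Data.Bool using (Bool; true; false)
open import Data.Bool.Properties using (∨-conicalˡ; ∨-conicalʳ)
open import Data.Fin using (Fin; zero; suc; splitAt; _↑ˡ_; _↑ʳ_; remQuot)
open import Data.Fin.Properties using (all?; ¬∀⟶∃¬; splitAt-↑ˡ; splitAt-↑ʳ; splitAt⁻¹-↑ʳ)
  renaming (_≟_ to _≟ᶠ_)
open import Data.Fin.Subset
open import Data.Fin.Subset.Properties
open import Data.List using (List; []; _∷_; allFin; filter)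
open import Data.List.Membership.Propositional using () renaming (_∈_ to _∈ₗ_)
open import Data.List.Membership.Propositional.Properties using (∈-allFin; ∈-filter⁺; ∈-filter⁻)
import Data.List.Relation.Unary.Any as Any
open import Data.Vec using ([]; _∷_; here; there; lookup; _++_)
open import Data.Vec.Properties
  using ([]=⇒lookup; lookup⇒[]=; lookup∘tabulate; tabulate∘lookup; tabulate-cong; lookup-splitAt; lookup-replicate)
open import Data.Product using (∃-syntax; _×_; _,_; proj₁; proj₂)
open import Data.Sum using (_⊎_; inj₁; inj₂; [_,_]′)
open import Function using (id; _∘_; const; _∋_)
open import Induction.WellFounded using (Acc; acc)
open import Relation.Nullary using (Dec; yes; no; contradiction)
open import Relation.Nullary.Decidable using (⌊_⌋; _→-dec_)
open import Relation.Binary.PropositionalEquality using (_≡_; _≢_; refl; sym; trans; cong; subst)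

private variable
  k : ℕ
  x y : Fin k
  A B : Subset k

⌊⌋-true⁺ : ∀ {P : Set} (p? : Dec P) → P → ⌊ p? ⌋ ≡ true
⌊⌋-true⁺ (yes _) _ = refl
⌊⌋-true⁺ (no ¬p) p = contradiction p ¬p

⌊⌋-true⁻ : ∀ {P : Set} (p? : Dec P) → ⌊ p? ⌋ ≡ true → P
⌊⌋-true⁻ (yes p) _ = p

anyFin⁻ : ∀ k (f : Fin k → Bool) → anyFin k f ≡ true → ∃[ i ] f i ≡ true
anyFin⁻ (suc k) f any≡true with f zero in f0≡true
... | true  = zero , f0≡true
... | false with anyFin⁻ k (f ∘ suc) any≡true
...   | i , fi≡true = suc i , fi≡true

anyFin-false⁻ : ∀ k (f : Fin k → Bool) → anyFin k f ≡ false → ∀ i → f i ≡ false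
anyFin-false⁻ (suc k) f any≡false zero    = ∨-conicalˡ _ _ any≡false
anyFin-false⁻ (suc k) f any≡false (suc i) = anyFin-false⁻ k (f ∘ suc) (∨-conicalʳ _ _ any≡false) i

lookup-ext : (∀ i → lookup A i ≡ lookup B i) → A ≡ B
lookup-ext {A = A} {B} eq = trans (sym (tabulate∘lookup A)) (trans (tabulate-cong eq) (tabulate∘lookup B))

x∈p─q⇒x∉q : ∀ (A B : Subset k) → x ∈ A ─ B → x ∉ B
x∈p─q⇒x∉q (s ∷ A) (outside ∷ B) here ()
x∈p─q⇒x∉q (s ∷ A) (t ∷ B) (there x∈A─B) (there x∈B) = x∈p─q⇒x∉q A B x∈A─B x∈B

x∈p⇒1≤∣p∣ : x ∈ A → 1 ≤ ∣ A ∣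
x∈p⇒1≤∣p∣ x∈p = ≤-trans (s≤s z≤n) (x∈p⇒∣p-x∣<∣p∣ x∈p)

x∈p∧y∈p∧x≢y⇒2≤∣p∣ : x ∈ A → y ∈ A → x ≢ y → 2 ≤ ∣ A ∣
x∈p∧y∈p∧x≢y⇒2≤∣p∣ x∈p y∈p x≢y =
  ≤-trans (s≤s (x∈p⇒1≤∣p∣ (x∈p∧x≢y⇒x∈p-y y∈p (x≢y ∘ sym)))) (x∈p⇒∣p-x∣<∣p∣ x∈p)

∣p∣≤1+∣p-x∣ : ∀ (A : Subset k) x → ∣ A ∣ ≤ suc ∣ A - x ∣
∣p∣≤1+∣p-x∣ (inside  ∷ A) zero    = s≤s (≤-reflexive (cong ∣_∣ (sym (p─⊥≡p A))))
∣p∣≤1+∣p-x∣ (outside ∷ A) zero    = ≤-trans (n≤1+n ∣ A ∣) (s≤s (≤-reflexive (cong ∣_∣ (sym (p─⊥≡p A)))))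
∣p∣≤1+∣p-x∣ (inside  ∷ A) (suc x) = s≤s (∣p∣≤1+∣p-x∣ A x)
∣p∣≤1+∣p-x∣ (outside ∷ A) (suc x) = ∣p∣≤1+∣p-x∣ A x

∣p++⊥∣≡∣p∣ : ∀ {j} (A : Subset k) → ∣ A ++ ⊥ {n = j} ∣ ≡ ∣ A ∣
∣p++⊥∣≡∣p∣ {j = j} []      = ∣⊥∣≡0 j
∣p++⊥∣≡∣p∣ (inside  ∷ A) = cong suc (∣p++⊥∣≡∣p∣ A)
∣p++⊥∣≡∣p∣ (outside ∷ A) = ∣p++⊥∣≡∣p∣ A

adjoin : List (Fin k) → Subset k → Subset k
adjoin []       X = X
adjoin (x ∷ xs) X = adjoin xs X ∪ ⁅ x ⁆

⊆adjoin : ∀ xs (X : Subset k) → X ⊆ adjoin xs X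
⊆adjoin []       X = id
⊆adjoin (x ∷ xs) X = p⊆p∪q ⁅ x ⁆ ∘ ⊆adjoin xs X

∈adjoin : ∀ {xs} (X : Subset k) → x ∈ₗ xs → x ∈ adjoin xs X
∈adjoin {xs = x ∷ xs} X (Any.here refl) = q⊆p∪q (adjoin xs X) ⁅ x ⁆ (x∈⁅x⁆ x)
∈adjoin {xs = x ∷ xs} X (Any.there x∈xs) = p⊆p∪q ⁅ x ⁆ (∈adjoin X x∈xs)

module MatroidProperties {k : ℕ} (N : Matroid k) where
  open Matroid N

  r-⊆ : A ⊆ B → r A ≤ r B
  r-⊆ = r-mono _ _

  r-∪-≤ : ∀ A B → r (A ∪ B) ≤ r A + ∣ B ∣
  r-∪-≤ A B = ≤-trans (m≤m+n _ _) (≤-trans (r-sub A B) (+-monoʳ-≤ (r A) (r-card B)))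

  r-∪⁅⁆-≤ : ∀ X y → r (X ∪ ⁅ y ⁆) ≤ suc (r X)
  r-∪⁅⁆-≤ X y = subst (r (X ∪ ⁅ y ⁆) ≤_) (trans (cong (r X +_) (∣⁅x⁆∣≡1 y)) (+-comm (r X) 1))
                      (r-∪-≤ X ⁅ y ⁆)

  r-≤-r+∣─∣ : ∀ A B → r A ≤ r B + ∣ A ─ B ∣
  r-≤-r+∣─∣ A B = ≤-trans (r-⊆ A⊆B∪A─B) (r-∪-≤ B (A ─ B))
    where
    A⊆B∪A─B : A ⊆ B ∪ (A ─ B)
    A⊆B∪A─B {x} x∈A with x ∈? B
    ... | yes x∈B = x∈p∪q⁺ (inj₁ x∈B)
    ... | no  x∉B = x∈p∪q⁺ (inj₂ (x∈p∧x∉q⇒x∈p─q x∈A x∉B))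

  ∈cl⁻ : ∀ {X} → y ∈ cl N X → r (X ∪ ⁅ y ⁆) ≡ r X
  ∈cl⁻ {y = y} {X} y∈cl =
    ⌊⌋-true⁻ (r (X ∪ ⁅ y ⁆) ≟ℕ r X) (trans (sym (lookup∘tabulate _ y)) ([]=⇒lookup y∈cl))

  ∈cl⁺ : ∀ {X} → r (X ∪ ⁅ y ⁆) ≡ r X → y ∈ cl N X
  ∈cl⁺ {y = y} {X} eq =
    lookup⇒[]= y (cl N X) (trans (lookup∘tabulate _ y) (⌊⌋-true⁺ (r (X ∪ ⁅ y ⁆) ≟ℕ r X) eq))

  ∉cl⇒r-∪⁅⁆ : ∀ {X} → y ∉ cl N X → r (X ∪ ⁅ y ⁆) ≡ suc (r X)
  ∉cl⇒r-∪⁅⁆ {y = y} {X} y∉cl =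
    ≤-antisym (r-∪⁅⁆-≤ X y) (≤∧≢⇒< (r-⊆ (p⊆p∪q ⁅ y ⁆)) (y∉cl ∘ ∈cl⁺ ∘ sym))

  ⊆cl : ∀ X → X ⊆ cl N X
  ⊆cl X {x} x∈X = ∈cl⁺ (≤-antisym (r-⊆ X∪x⊆X) (r-⊆ (p⊆p∪q ⁅ x ⁆)))
    where
    X∪x⊆X : X ∪ ⁅ x ⁆ ⊆ X
    X∪x⊆X z∈ with x∈p∪q⁻ X ⁅ x ⁆ z∈
    ... | inj₁ z∈X = z∈X
    ... | inj₂ z∈x = subst (_∈ X) (sym (x∈⁅y⁆⇒x≡y x z∈x)) x∈X

  ∈cl-mono : ∀ {X W} → X ⊆ W → y ∈ cl N X → y ∈ cl N W
  ∈cl-mono {y = y} {X} {W} X⊆W y∈cl = ∈cl⁺ (≤-antisym r[W∪y]≤r[W] (r-⊆ (p⊆p∪q ⁅ y ⁆)))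
    where
    open ≤-Reasoning
    W∪y⊆W∪X∪y : W ∪ ⁅ y ⁆ ⊆ W ∪ (X ∪ ⁅ y ⁆)
    W∪y⊆W∪X∪y z∈ with x∈p∪q⁻ W ⁅ y ⁆ z∈
    ... | inj₁ z∈W = x∈p∪q⁺ (inj₁ z∈W)
    ... | inj₂ z∈y = x∈p∪q⁺ (inj₂ (q⊆p∪q X ⁅ y ⁆ z∈y))
    X⊆W∩X∪y : X ⊆ W ∩ (X ∪ ⁅ y ⁆)
    X⊆W∩X∪y z∈X = x∈p∩q⁺ (X⊆W z∈X , p⊆p∪q ⁅ y ⁆ z∈X)
    r[W∪y]≤r[W] : r (W ∪ ⁅ y ⁆) ≤ r W
    r[W∪y]≤r[W] = +-cancelʳ-≤ (r X) _ _ (begin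
      r (W ∪ ⁅ y ⁆) + r X                          ≤⟨ +-mono-≤ (r-⊆ W∪y⊆W∪X∪y) (r-⊆ X⊆W∩X∪y) ⟩
      r (W ∪ (X ∪ ⁅ y ⁆)) + r (W ∩ (X ∪ ⁅ y ⁆))  ≤⟨ r-sub W (X ∪ ⁅ y ⁆) ⟩
      r W + r (X ∪ ⁅ y ⁆)                          ≡⟨ cong (r W +_) (∈cl⁻ y∈cl) ⟩
      r W + r X                                    ∎)

  r-adjoin : ∀ xs X → (∀ {x} → x ∈ₗ xs → x ∈ cl N X) → r (adjoin xs X) ≡ r X
  r-adjoin []       X _      = refl
  r-adjoin (x ∷ xs) X xs⊆cl =
    trans (∈cl⁻ (∈cl-mono (⊆adjoin xs X) (xs⊆cl (Any.here refl)))) (r-adjoin xs X (xs⊆cl ∘ Any.there))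

  r-cl : ∀ X → r (cl N X) ≡ r X
  r-cl X = ≤-antisym (≤-trans (r-⊆ cl⊆adjoin) (≤-reflexive r[adjoin]≡r[X])) (r-⊆ (⊆cl X))
    where
    xs : List (Fin k)
    xs = filter (_∈? cl N X) (allFin k)
    cl⊆adjoin : cl N X ⊆ adjoin xs X
    cl⊆adjoin {x} x∈cl = ∈adjoin X (∈-filter⁺ (_∈? cl N X) (∈-allFin x) x∈cl)
    r[adjoin]≡r[X] : r (adjoin xs X) ≡ r X
    r[adjoin]≡r[X] = r-adjoin xs X (proj₂ ∘ ∈-filter⁻ (_∈? cl N X) {xs = allFin k})

  ⊆cl⇒r≤ : ∀ {B} → A ⊆ cl N B → r A ≤ r B
  ⊆cl⇒r≤ {B = B} A⊆cl = ≤-trans (r-⊆ A⊆cl) (≤-reflexive (r-cl B))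

  cl-isFlat : ∀ X → IsFlat N (cl N X)
  cl-isFlat X = ⊆-antisym cl[clX]⊆clX (⊆cl (cl N X))
    where
    cl[clX]⊆clX : cl N (cl N X) ⊆ cl N X
    cl[clX]⊆clX {y} y∈cl = ∈cl⁺ (≤-antisym (begin
      r (X ∪ ⁅ y ⁆)       ≤⟨ r-⊆ X∪y⊆clX∪y ⟩
      r (cl N X ∪ ⁅ y ⁆)  ≡⟨ ∈cl⁻ y∈cl ⟩
      r (cl N X)          ≡⟨ r-cl X ⟩
      r X                 ∎) (r-⊆ (p⊆p∪q ⁅ y ⁆)))
      where
      open ≤-Reasoning
      X∪y⊆clX∪y : X ∪ ⁅ y ⁆ ⊆ cl N X ∪ ⁅ y ⁆
      X∪y⊆clX∪y z∈ with x∈p∪q⁻ X ⁅ y ⁆ z∈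
      ... | inj₁ z∈X = x∈p∪q⁺ (inj₁ (⊆cl X z∈X))
      ... | inj₂ z∈y = x∈p∪q⁺ (inj₂ z∈y)

  private
    not-coloop? : ∀ W e → Dec (e ∈ W → r (W - e) ≡ r W)
    not-coloop? W e = (e ∈? W) →-dec (r (W - e) ≟ℕ r W)

  cyclic-or-coloop : ∀ W → IsCyclic N W ⊎ ∃[ c ] c ∈ W × r (W - c) ≢ r W
  cyclic-or-coloop W with all? (not-coloop? W)
  ... | yes cyclic = inj₁ cyclic
  ... | no ¬cyclic with ¬∀⟶∃¬ k _ (not-coloop? W) ¬cyclic
  ...   | c , ¬Pc with c ∈? W
  ...     | yes c∈W = inj₂ (c , c∈W , ¬Pc ∘ const)
  ...     | no  c∉W = contradiction (λ c∈W → contradiction c∈W c∉W) ¬Pc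

  coloop-of-cl : ∀ {X c} → c ∈ cl N X → r (cl N X - c) ≢ r (cl N X) → c ∈ X × r (X - c) < r X
  coloop-of-cl {X} {c} c∈cl coloop = c∈X , ≤-<-trans (r-⊆ X-c⊆clX-c) r[clX-c]<r[X]
    where
    r[clX-c]<r[X] : r (cl N X - c) < r X
    r[clX-c]<r[X] = subst (r (cl N X - c) <_) (r-cl X) (≤∧≢⇒< (r-⊆ (p─q⊆p _ _)) coloop)
    X-c⊆clX-c : X - c ⊆ cl N X - c
    X-c⊆clX-c z∈ = x∈p∧x∉q⇒x∈p─q (⊆cl X (p─q⊆p _ _ z∈)) (x∈p─q⇒x∉q _ _ z∈)
    c∈X : c ∈ X
    c∈X with c ∈? X
    ... | yes c∈X = c∈X
    ... | no  c∉X = contradiction (≤-<-trans (r-⊆ X⊆clX-c) r[clX-c]<r[X]) (<-irrefl refl)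
      where
      X⊆clX-c : X ⊆ cl N X - c
      X⊆clX-c z∈X = x∈p∧x≢y⇒x∈p-y (⊆cl X z∈X) λ { refl → c∉X z∈X }

  -- One half of r(X) = min { r(Z) + |X ─ Z| : Z cyclic flat }, by deleting coloops of cl(X) until it is cyclic.
  cyclic-flat-bound : ∀ X → ∃[ Z ] IsCyclicFlat N Z × r Z + ∣ X ─ Z ∣ ≤ r X
  cyclic-flat-bound X = go X (<-wellFounded ∣ X ∣)
    where
    go : ∀ X → Acc _<_ ∣ X ∣ → ∃[ Z ] IsCyclicFlat N Z × r Z + ∣ X ─ Z ∣ ≤ r X
    go X (acc smaller) with cyclic-or-coloop (cl N X)
    ... | inj₁ cyclic = cl N X , (cl-isFlat X , cyclic) , (begin
      r (cl N X) + ∣ X ─ cl N X ∣  ≤⟨ +-monoʳ-≤ (r (cl N X)) ∣X─clX∣≤0 ⟩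
      r (cl N X) + 0               ≡⟨ +-identityʳ _ ⟩
      r (cl N X)                   ≡⟨ r-cl X ⟩
      r X                          ∎)
      where
      open ≤-Reasoning
      ∣X─clX∣≤0 : ∣ X ─ cl N X ∣ ≤ 0
      ∣X─clX∣≤0 = ≤-trans (p⊆q⇒∣p∣≤∣q∣ X─clX⊆⊥) (≤-reflexive (∣⊥∣≡0 k))
        where
        X─clX⊆⊥ : X ─ cl N X ⊆ ⊥
        X─clX⊆⊥ z∈ = contradiction (⊆cl X (p─q⊆p X (cl N X) z∈)) (x∈p─q⇒x∉q X (cl N X) z∈)
    ... | inj₂ (c , c∈clX , coloop) with coloop-of-cl c∈clX coloop
    ...   | c∈X , r[X-c]<r[X] with go (X - c) (smaller (x∈p⇒∣p-x∣<∣p∣ c∈X))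
    ...     | Z , cyclicFlat , bound = Z , cyclicFlat , (begin
      r Z + ∣ X ─ Z ∣            ≤⟨ +-monoʳ-≤ (r Z) (∣p∣≤1+∣p-x∣ (X ─ Z) c) ⟩
      r Z + suc ∣ X ─ Z - c ∣    ≡⟨ cong (λ W → r Z + suc ∣ W ∣) (p─q─r≡p─r─q X Z ⁅ c ⁆) ⟩
      r Z + suc ∣ X - c ─ Z ∣    ≡⟨ +-suc (r Z) _ ⟩
      suc (r Z + ∣ X - c ─ Z ∣)  ≤⟨ s≤s bound ⟩
      suc (r (X - c))            ≤⟨ r[X-c]<r[X] ⟩
      r X                        ∎)
      where open ≤-Reasoning

  loopless⇒1≤r : Loopless N → x ∈ A → 1 ≤ r A
  loopless⇒1≤r {x = x} loopless x∈A =
    ≤-trans (≤-reflexive (sym (loopless x))) (r-⊆ λ z∈ → subst (_∈ _) (sym (x∈⁅y⁆⇒x≡y x z∈)) x∈A)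

-- embed, q and p tabulate where-bound functions that cannot be named. Their lookups are therefore taken
-- from lookup∘tabulate with the function inferred, and reduce once decode n m x is abstracted by with.
module ConeEncoding (n m : ℕ) where

  LiesOver : Fin n → Fin (QSize n m) → Set
  LiesOver e x = decode n m x ≡ el e ⊎ ∃[ j ] decode n m x ≡ tee e j

  decode-tip : decode n m (tip n m) ≡ apex
  decode-tip rewrite splitAt-↑ʳ n (n * m + 1) ((n * m) ↑ʳ zero) | splitAt-↑ʳ (n * m) 1 zero = refl

  decode-↑ˡ : ∀ e → decode n m (e ↑ˡ (n * m + 1)) ≡ el e
  decode-↑ˡ e rewrite splitAt-↑ˡ n e (n * m + 1) = refl

  decode≡apex⇒tip : ∀ x → decode n m x ≡ apex → x ≡ tip n m
  decode≡apex⇒tip x eq with splitAt n x in split₁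
  ... | inj₁ _ with () ← eq
  ... | inj₂ y with splitAt (n * m) y in split₂
  ...   | inj₁ t with remQuot {n} m t
  ...     | _ with () ← eq
  decode≡apex⇒tip x eq | inj₂ y | inj₂ zero =
    trans (sym (splitAt⁻¹-↑ʳ split₁)) (cong (n ↑ʳ_) (sym (splitAt⁻¹-↑ʳ split₂)))

  liesOver⇒≢tip : ∀ {e x} → LiesOver e x → x ≢ tip n m
  liesOver⇒≢tip (inj₁ d)       refl with () ← trans (sym d) decode-tip
  liesOver⇒≢tip (inj₂ (_ , d)) refl with () ← trans (sym d) decode-tip

  ∈embed⁺ : ∀ Y {x e} → decode n m x ≡ el e → e ∈ Y → x ∈ embed n m Y
  ∈embed⁺ Y {x} {e} d e∈Y with decode n m x | (lookup (embed n m Y) x ≡ _) ∋ lookup∘tabulate _ x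
  ∈embed⁺ Y {x} {e} refl e∈Y | _ | lookup≡ = lookup⇒[]= x (embed n m Y) (trans lookup≡ ([]=⇒lookup e∈Y))

  ∈embed⁻ : ∀ Y {x} → x ∈ embed n m Y → ∃[ e ] decode n m x ≡ el e × e ∈ Y
  ∈embed⁻ Y {x} x∈ with decode n m x in d | (lookup (embed n m Y) x ≡ _) ∋ lookup∘tabulate _ x
  ... | el e    | lookup≡ = e , refl , lookup⇒[]= e Y (trans (sym lookup≡) ([]=⇒lookup x∈))
  ... | tee _ _ | lookup≡ with () ← trans (sym lookup≡) ([]=⇒lookup x∈)
  ... | apex    | lookup≡ with () ← trans (sym lookup≡) ([]=⇒lookup x∈)

  liesOver-or-tip : ∀ x → (∃[ e ] LiesOver e x) ⊎ x ≡ tip n m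
  liesOver-or-tip x with decode n m x in d
  ... | el e    = inj₁ (e , inj₁ refl)
  ... | tee e j = inj₁ (e , inj₂ (j , refl))
  ... | apex    = inj₂ (decode≡apex⇒tip x d)

  tip∉embed : ∀ Y → tip n m ∉ embed n m Y
  tip∉embed Y tip∈ with ∈embed⁻ Y tip∈
  ... | _ , d , _ with () ← trans (sym decode-tip) d

  embed≡++⊥ : ∀ Y → embed n m Y ≡ Y ++ ⊥
  embed≡++⊥ Y = lookup-ext λ x → trans (lookup-embed x) (sym (lookup-splitAt n Y ⊥ x))
    where
    lookup-embed : ∀ x → lookup (embed n m Y) x ≡ [ lookup Y , lookup ⊥ ]′ (splitAt n x)
    lookup-embed x with splitAt n x | (lookup (embed n m Y) x ≡ _) ∋ lookup∘tabulate _ x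
    ... | inj₁ e | lookup≡ = lookup≡
    ... | inj₂ y | lookup≡ with splitAt (n * m) y
    ...   | inj₁ t with remQuot {n} m t
    ...     | _ = trans lookup≡ (sym (lookup-replicate y outside))
    lookup-embed x | inj₂ y | lookup≡ | inj₂ _ = trans lookup≡ (sym (lookup-replicate y outside))

  ∣embed∣ : ∀ Y → ∣ embed n m Y ∣ ≡ ∣ Y ∣
  ∣embed∣ Y = trans (cong ∣_∣ (embed≡++⊥ Y)) (∣p++⊥∣≡∣p∣ Y)

  private
    q-over : ∀ F {e x} → LiesOver e x → lookup (q n m F) x ≡ lookup F e
    q-over F {x = x} over with decode n m x | over | (lookup (q n m F) x ≡ _) ∋ lookup∘tabulate _ x
    ... | _ | inj₁ refl       | lookup≡ = lookup≡
    ... | _ | inj₂ (_ , refl) | lookup≡ = lookup≡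

  ∈q⁺ : ∀ F {e x} → LiesOver e x → e ∈ F → x ∈ q n m F
  ∈q⁺ F {e} {x} over e∈F = lookup⇒[]= x (q n m F) (trans (q-over F over) ([]=⇒lookup e∈F))

  ∈q⁻ : ∀ F {e x} → LiesOver e x → x ∈ q n m F → e ∈ F
  ∈q⁻ F {e} {x} over x∈q = lookup⇒[]= e F (trans (sym (q-over F over)) ([]=⇒lookup x∈q))

  tip∈q : ∀ F → tip n m ∈ q n m F
  tip∈q F with decode n m (tip n m) | decode-tip
              | (lookup (q n m F) (tip n m) ≡ _) ∋ lookup∘tabulate _ (tip n m)
  ... | _ | refl | lookup≡ = lookup⇒[]= (tip n m) (q n m F) lookup≡

  ∈p⁺ : ∀ S {x e} → x ∈ S → LiesOver e x → e ∈ p n m S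
  ∈p⁺ S {x} {e} x∈S over with lookup (p n m S) e in p[e]
  ... | true  = lookup⇒[]= e (p n m S) p[e]
  ... | false with decode n m x | over | lookup S x | []=⇒lookup x∈S
                  | anyFin-false⁻ _ _ (trans (sym (lookup∘tabulate _ e)) p[e]) x
  ...   | _ | inj₁ refl       | _ | refl | ≡false with () ← trans (sym (⌊⌋-true⁺ (e ≟ᶠ e) refl)) ≡false
  ...   | _ | inj₂ (_ , refl) | _ | refl | ≡false with () ← trans (sym (⌊⌋-true⁺ (e ≟ᶠ e) refl)) ≡false

  ∈p⁻ : ∀ S {e} → e ∈ p n m S → ∃[ x ] x ∈ S × LiesOver e x
  ∈p⁻ S {e} e∈ with anyFin⁻ _ _ (trans (sym (lookup∘tabulate _ e)) ([]=⇒lookup e∈))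
  ... | x , fx≡true with lookup S x in S[x] | decode n m x in d | fx≡true
  ... | true | el e′    | ≡true with refl ← ⌊⌋-true⁻ (e ≟ᶠ e′) ≡true = x , lookup⇒[]= x S S[x] , inj₁ d
  ... | true | tee e′ j | ≡true with refl ← ⌊⌋-true⁻ (e ≟ᶠ e′) ≡true = x , lookup⇒[]= x S S[x] , inj₂ (j , d)

module FreeCone (m : ℕ) {n : ℕ} (M : Matroid n) (loopless : Loopless M)
                (Q : Matroid (QSize n m)) (isCone : IsFreeCone m M Q) where

  open IsFreeCone isCone
  open ConeEncoding n m
  private
    module MP = MatroidProperties M
    module QP = MatroidProperties Q
    rM = Matroid.r M
    rQ = Matroid.r Q
    a = tip n m

  rank-tip-pair : ∀ {e y} → LiesOver e y → 2 ≤ rQ (⁅ a ⁆ ∪ ⁅ y ⁆)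
  rank-tip-pair {e} {y} y-over with QP.cyclic-flat-bound (⁅ a ⁆ ∪ ⁅ y ⁆)
  ... | Z , cyclicFlat , bound with proj₁ (cyclicFlats Z) cyclicFlat
  ...   | inj₁ (Z′ , cyclicFlatZ′ , refl) = ≤-trans embedded-case bound
    where
    a∈ : a ∈ ⁅ a ⁆ ∪ ⁅ y ⁆ ─ embed n m Z′
    a∈ = x∈p∧x∉q⇒x∈p─q (p⊆p∪q ⁅ y ⁆ (x∈⁅x⁆ a)) (tip∉embed Z′)
    embedded-case : 2 ≤ rQ (embed n m Z′) + ∣ ⁅ a ⁆ ∪ ⁅ y ⁆ ─ embed n m Z′ ∣
    embedded-case with y ∈? embed n m Z′
    ... | no y∉Z = ≤-trans (x∈p∧y∈p∧x≢y⇒2≤∣p∣ a∈ y∈ (liesOver⇒≢tip y-over ∘ sym)) (m≤n+m _ _)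
      where
      y∈ : y ∈ ⁅ a ⁆ ∪ ⁅ y ⁆ ─ embed n m Z′
      y∈ = x∈p∧x∉q⇒x∈p─q (q⊆p∪q ⁅ a ⁆ ⁅ y ⁆ (x∈⁅x⁆ y)) y∉Z
    ... | yes y∈Z with ∈embed⁻ Z′ y∈Z
    ...   | _ , _ , e′∈Z′ = +-mono-≤ (subst (1 ≤_) (sym (rank-Z Z′ cyclicFlatZ′)) (MP.loopless⇒1≤r loopless e′∈Z′))
                                   (x∈p⇒1≤∣p∣ a∈)
  ...   | inj₂ (F , flatF , nonemptyF , refl) = ≤-trans cone-case bound
    where
    cone-case : 2 ≤ rQ (q n m F) + ∣ ⁅ a ⁆ ∪ ⁅ y ⁆ ─ q n m F ∣
    cone-case rewrite rank-q F flatF nonemptyF with e ∈? F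
    ... | yes e∈F = ≤-trans (+-mono-≤ (MP.loopless⇒1≤r loopless e∈F) ≤-refl) (m≤m+n _ _)
    ... | no  e∉F = +-mono-≤ {1} (m≤n+m 1 (rM F)) (x∈p⇒1≤∣p∣ y∈)
      where
      y∈ : y ∈ ⁅ a ⁆ ∪ ⁅ y ⁆ ─ q n m F
      y∈ = x∈p∧x∉q⇒x∈p─q (q⊆p∪q ⁅ a ⁆ ⁅ y ⁆ (x∈⁅x⁆ y)) (e∉F ∘ ∈q⁻ F y-over)

  ∈cl-tip-pair : ∀ {e x y} → LiesOver e x → LiesOver e y → x ∈ cl Q (⁅ a ⁆ ∪ ⁅ y ⁆)
  ∈cl-tip-pair {e} {x} {y} x-over y-over = QP.∈cl⁺ (≤-antisym (begin
      rQ ((⁅ a ⁆ ∪ ⁅ y ⁆) ∪ ⁅ x ⁆)  ≤⟨ QP.r-⊆ ⊆qF ⟩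
      rQ (q n m F)                  ≡⟨ rank-q F (MP.cl-isFlat ⁅ e ⁆) (e , e∈F) ⟩
      rM F + 1                      ≡⟨ cong (_+ 1) (trans (MP.r-cl ⁅ e ⁆) (loopless e)) ⟩
      2                             ≤⟨ rank-tip-pair y-over ⟩
      rQ (⁅ a ⁆ ∪ ⁅ y ⁆)            ∎)
    (QP.r-⊆ (p⊆p∪q ⁅ x ⁆)))
    where
    open ≤-Reasoning
    F : Subset n
    F = cl M ⁅ e ⁆
    e∈F : e ∈ F
    e∈F = MP.⊆cl ⁅ e ⁆ (x∈⁅x⁆ e)
    ⊆qF : (⁅ a ⁆ ∪ ⁅ y ⁆) ∪ ⁅ x ⁆ ⊆ q n m F
    ⊆qF z∈ with x∈p∪q⁻ (⁅ a ⁆ ∪ ⁅ y ⁆) ⁅ x ⁆ z∈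
    ... | inj₂ z∈x rewrite x∈⁅y⁆⇒x≡y x z∈x = ∈q⁺ F x-over e∈F
    ... | inj₁ z∈ay with x∈p∪q⁻ ⁅ a ⁆ ⁅ y ⁆ z∈ay
    ...   | inj₁ z∈a rewrite x∈⁅y⁆⇒x≡y a z∈a = tip∈q F
    ...   | inj₂ z∈y rewrite x∈⁅y⁆⇒x≡y y z∈y = ∈q⁺ F y-over e∈F

  ∈cl-fibre : ∀ {e x y B} → LiesOver e x → LiesOver e y → a ∈ B → y ∈ B → x ∈ cl Q B
  ∈cl-fibre {y = y} {B} x-over y-over a∈B y∈B = QP.∈cl-mono ay⊆B (∈cl-tip-pair x-over y-over)
    where
    ay⊆B : ⁅ a ⁆ ∪ ⁅ y ⁆ ⊆ B
    ay⊆B z∈ with x∈p∪q⁻ ⁅ a ⁆ ⁅ y ⁆ z∈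
    ... | inj₁ z∈a rewrite x∈⁅y⁆⇒x≡y a z∈a = a∈B
    ... | inj₂ z∈y rewrite x∈⁅y⁆⇒x≡y y z∈y = y∈B

  r-embed-≤ : ∀ F → rQ (embed n m F) ≤ rM F
  r-embed-≤ F with MP.cyclic-flat-bound F
  ... | Z , cyclicFlatZ , bound = begin
    rQ (embed n m F)                                    ≤⟨ QP.r-≤-r+∣─∣ (embed n m F) (embed n m Z) ⟩
    rQ (embed n m Z) + ∣ embed n m F ─ embed n m Z ∣    ≤⟨ +-mono-≤ (≤-reflexive (rank-Z Z cyclicFlatZ)) ∣─∣≤ ⟩
    rM Z + ∣ F ─ Z ∣                                    ≤⟨ bound ⟩
    rM F                                                ∎
    where
    open ≤-Reasoning
    ─⊆ : embed n m F ─ embed n m Z ⊆ embed n m (F ─ Z)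
    ─⊆ z∈ with ∈embed⁻ F (p─q⊆p _ _ z∈)
    ... | _ , d , e∈F = ∈embed⁺ (F ─ Z) d (x∈p∧x∉q⇒x∈p─q e∈F (x∈p─q⇒x∉q _ _ z∈ ∘ ∈embed⁺ Z d))
    ∣─∣≤ : ∣ embed n m F ─ embed n m Z ∣ ≤ ∣ F ─ Z ∣
    ∣─∣≤ = ≤-trans (p⊆q⇒∣p∣≤∣q∣ ─⊆) (≤-reflexive (∣embed∣ (F ─ Z)))

  -- With cyclic-flat-bound this makes the tip a coloop of embed(X) ∪ {a}.
  r-embed<bound : ∀ X Z → IsCyclicFlat Q Z → rQ (embed n m X) < rQ Z + ∣ embed n m X ∪ ⁅ a ⁆ ─ Z ∣
  r-embed<bound X Z cyclicFlat with proj₁ (cyclicFlats Z) cyclicFlat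
  ... | inj₁ (Z′ , _ , refl) = ≤-<-trans (QP.r-≤-r+∣─∣ (embed n m X) (embed n m Z′)) (+-monoʳ-< _ (p⊂q⇒∣p∣<∣q∣ ⊂))
    where
    ⊂ : embed n m X ─ embed n m Z′ ⊂ embed n m X ∪ ⁅ a ⁆ ─ embed n m Z′
    ⊂ = (λ z∈ → x∈p∧x∉q⇒x∈p─q (p⊆p∪q ⁅ a ⁆ (p─q⊆p _ _ z∈)) (x∈p─q⇒x∉q _ _ z∈))
      , a , x∈p∧x∉q⇒x∈p─q (q⊆p∪q (embed n m X) ⁅ a ⁆ (x∈⁅x⁆ a)) (tip∉embed Z′)
      , tip∉embed X ∘ p─q⊆p _ _
  ... | inj₂ (F , flatF , nonemptyF , refl) = begin-strict
    rQ (embed n m X)                                  ≤⟨ QP.r-≤-r+∣─∣ (embed n m X) (embed n m F) ⟩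
    rQ (embed n m F) + ∣ embed n m X ─ embed n m F ∣  ≤⟨ +-mono-≤ (r-embed-≤ F) (p⊆q⇒∣p∣≤∣q∣ ⊆) ⟩
    rM F + D                                          <⟨ n<1+n _ ⟩
    suc (rM F) + D                                    ≡⟨ cong (_+ D) r[qF]≡1+r[F] ⟩
    rQ (q n m F) + D                                  ∎
    where
    open ≤-Reasoning
    D : ℕ
    D = ∣ embed n m X ∪ ⁅ a ⁆ ─ q n m F ∣
    r[qF]≡1+r[F] : suc (rM F) ≡ rQ (q n m F)
    r[qF]≡1+r[F] = trans (+-comm 1 (rM F)) (sym (rank-q F flatF nonemptyF))
    ⊆ : embed n m X ─ embed n m F ⊆ embed n m X ∪ ⁅ a ⁆ ─ q n m F
    ⊆ z∈ with ∈embed⁻ X (p─q⊆p _ _ z∈)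
    ... | _ , d , _ = x∈p∧x∉q⇒x∈p─q (p⊆p∪q ⁅ a ⁆ (p─q⊆p _ _ z∈))
                                    (x∈p─q⇒x∉q _ _ z∈ ∘ ∈embed⁺ F d ∘ ∈q⁻ F (inj₁ d))

  tip∉cl-embed : ∀ X → a ∉ cl Q (embed n m X)
  tip∉cl-embed X a∈cl with QP.cyclic-flat-bound (embed n m X ∪ ⁅ a ⁆)
  ... | Z , cyclicFlat , bound =
    <-irrefl refl (<-≤-trans (r-embed<bound X Z cyclicFlat) (≤-trans bound (≤-reflexive (QP.∈cl⁻ a∈cl))))

  r-∪tip≡1+r-p : ∀ S → rQ (S ∪ ⁅ a ⁆) ≡ suc (rQ (embed n m (p n m S)))
  r-∪tip≡1+r-p S = trans (≤-antisym (QP.⊆cl⇒r≤ S∪a⊆cl) (QP.⊆cl⇒r≤ pS∪a⊆cl))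
                          (QP.∉cl⇒r-∪⁅⁆ (tip∉cl-embed (p n m S)))
    where
    a∈S∪a : a ∈ S ∪ ⁅ a ⁆
    a∈S∪a = q⊆p∪q S ⁅ a ⁆ (x∈⁅x⁆ a)
    a∈pS∪a : a ∈ embed n m (p n m S) ∪ ⁅ a ⁆
    a∈pS∪a = q⊆p∪q (embed n m (p n m S)) ⁅ a ⁆ (x∈⁅x⁆ a)
    S∪a⊆cl : S ∪ ⁅ a ⁆ ⊆ cl Q (embed n m (p n m S) ∪ ⁅ a ⁆)
    S∪a⊆cl {z} z∈ with x∈p∪q⁻ S ⁅ a ⁆ z∈ | liesOver-or-tip z
    ... | inj₂ z∈a | _ rewrite x∈⁅y⁆⇒x≡y a z∈a = QP.⊆cl _ a∈pS∪a
    ... | inj₁ _   | inj₂ refl = QP.⊆cl _ a∈pS∪a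
    ... | inj₁ z∈S | inj₁ (e , z-over) =
      ∈cl-fibre z-over (inj₁ (decode-↑ˡ e)) a∈pS∪a
                (p⊆p∪q ⁅ a ⁆ (∈embed⁺ (p n m S) (decode-↑ˡ e) (∈p⁺ S z∈S z-over)))
    pS∪a⊆cl : embed n m (p n m S) ∪ ⁅ a ⁆ ⊆ cl Q (S ∪ ⁅ a ⁆)
    pS∪a⊆cl z∈ with x∈p∪q⁻ (embed n m (p n m S)) ⁅ a ⁆ z∈
    ... | inj₂ z∈a rewrite x∈⁅y⁆⇒x≡y a z∈a = QP.⊆cl _ a∈S∪a
    ... | inj₁ z∈pS with ∈embed⁻ (p n m S) z∈pS
    ...   | e , d , e∈pS with ∈p⁻ S e∈pS
    ...     | w , w∈S , w-over = ∈cl-fibre (inj₁ d) w-over a∈S∪a (p⊆p∪q ⁅ a ⁆ w∈S)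

corollary3p5 : (m : ℕ) → m ≥ 1 → {n : ℕ} → (M : Matroid n) → Loopless M →
               (Q : Matroid (QSize n m)) → IsFreeCone m M Q →
               (S : Subset (QSize n m)) →
               (tip n m ∉ cl Q S → Matroid.r Q (embed n m (p n m S)) ≡ Matroid.r Q S)
               × (tip n m ∈ cl Q S → Matroid.r Q (embed n m (p n m S)) + 1 ≡ Matroid.r Q S)
corollary3p5 m _ M loopless Q isCone S =
    (λ a∉cl → suc-injective (trans (sym (r-∪tip≡1+r-p S)) (QP.∉cl⇒r-∪⁅⁆ a∉cl)))
  , (λ a∈cl → trans (+-comm _ 1) (trans (sym (r-∪tip≡1+r-p S)) (QP.∈cl⁻ a∈cl)))
  where
  open FreeCone m M loopless Q isCone
  module QP = MatroidProperties Q
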